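{- For every integer $n\ge 1$, the number of equivalence classes of binary $2\times n$ matrices with exactly $n+1$ entries equal to $1$, where two matrices are equivalent if one can be obtained from the other by a cyclic permutation of columns, equals the $n$-th Catalan number $\frac{1}{n+1}\binom{2n}{n}$. -}

module Defs where

open import Data.Nat using (ℕ; zero; suc; _+_; _*_; _/_; NonZero)
open import Data.Nat.DivMod using (_mod_)
open import Data.Nat.Combinatorics using (_C_)
open import Data.Fin using (Fin; toℕ; zero; suc)
open import Data.Bool using (Bool; true; false)
open import Data.Product using (Σ; ∃; ∃-syntax; _×_)
open import Relation.Binary.PropositionalEquality using (_≡_)

-- A binary 2 × n matrix: entry (i , j) with row i : Fin 2, column j : Fin n.
Matrix : ℕ → Set
Matrix n = Fin 2 → Fin n → Bool

rowOnes : ∀ {n} → (Fin n → Bool) → ℕ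
rowOnes {zero}  r = 0
rowOnes {suc n} r with r zero
... | true  = suc (rowOnes (λ j → r (suc j)))
... | false = rowOnes (λ j → r (suc j))

ones : ∀ {n} → Matrix n → ℕ
ones M = rowOnes (M zero) + rowOnes (M (suc zero))

Adm : ℕ → Set
Adm n = Σ (Matrix n) (λ M → ones M ≡ suc n)

rotate : ∀ {n} .{{_ : NonZero n}} → ℕ → Matrix n → Matrix n
rotate {n} k M i j = M i ((toℕ j + k) mod n)

_∼_ : ∀ {n} .{{_ : NonZero n}} → Matrix n → Matrix n → Set
A ∼ B = ∃[ k ] (∀ i j → B i j ≡ rotate k A i j)

-- "The set X has exactly c equivalence classes under R":
-- there is a surjective class map X → Fin c identifying exactly the R-related elements.
HasClasses : {X : Set} → (X → X → Set) → ℕ → Set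
HasClasses {X} R c =
  Σ (X → Fin c) λ cls →
    (∀ (q : Fin c) → ∃[ x ] cls x ≡ q) ×
    (∀ x y → (cls x ≡ cls y → R x y) × (R x y → cls x ≡ cls y))

catalan : ℕ → ℕ
catalan n = ((2 * n) C n) / suc n

module Submission where

-- Write n = m + 1 and read a matrix column by column.  A matrix is dominant if every prefix of
-- l ≤ n columns contains more than l ones.  By the cycle lemma, every matrix with n + 1 ones has
-- exactly one dominant rotation among its n rotations.  Existence: start at the last position t < n
-- minimising (ones in the first t columns) − t.  Uniqueness: a second dominant rotation would split
-- the columns into two complementary windows each containing more ones than columns, i.e. n + 2
-- ones in total.  Hence sending a matrix to its dominant rotation classifies the rotation classes,
-- and the n rotations of a dominant matrix are pairwise distinct, so
-- n · #classes = #matrices with n + 1 ones = C(2n, n + 1); the absorption identity for binomial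
-- coefficients then turns this into #classes = C(2n, n) / (n + 1).

open import Defs
open import Data.Bool using (Bool; true; false; if_then_else_)
open import Data.Empty using (⊥; ⊥-elim)
open import Data.Fin using (Fin; toℕ; zero; suc; fromℕ<; combine; remQuot)
open import Data.Fin.Properties
  using (toℕ-injective; toℕ-fromℕ<; toℕ<n; fromℕ<-toℕ; injective⇒≤; combine-remQuot; combine-injective)
open import Data.Nat
open import Data.Nat.Properties
open import Data.Nat.DivMod using (_mod_; _%_; m%n%n≡m%n; [m+n]%n≡m%n; %-distribˡ-+; m<n⇒m%n≡m; m%n<n; m*n/n≡m)
open import Data.Nat.Combinatorics using (_C_; nCk+nC[k+1]≡[n+1]C[k+1]; nCk≡nC[n∸k]; nC1≡n)
open import Data.Nat.Tactic.RingSolver using (solve-∀)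
open import Data.Product using (∃; _×_; _,_; proj₁; proj₂; uncurry)
open import Data.Sum using (inj₁; inj₂)
open import Relation.Binary.Definitions using (tri<; tri≈; tri>)
open import Relation.Binary.PropositionalEquality
open import Relation.Nullary using (Dec; does; yes; no; contradiction)
open import Relation.Nullary.Decidable using (_×-dec_)
open import Relation.Unary using (Decidable)
open import Algebra.Properties.CommutativeSemigroup +-commutativeSemigroup
  using (interchange; xy∙z≈xz∙y; x∙yz≈y∙xz)

sumBelow : ℕ → (ℕ → ℕ) → ℕ
sumBelow zero    f = 0
sumBelow (suc l) f = sumBelow l f + f l

sumBelow-cong : ∀ l {f g : ℕ → ℕ} → (∀ j → j < l → f j ≡ g j) → sumBelow l f ≡ sumBelow l g
sumBelow-cong zero    f≗g = refl
sumBelow-cong (suc l) f≗g =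
  cong₂ _+_ (sumBelow-cong l (λ j j<l → f≗g j (m<n⇒m<1+n j<l))) (f≗g l ≤-refl)

sumBelow-split : ∀ a b (f : ℕ → ℕ) → sumBelow (a + b) f ≡ sumBelow a f + sumBelow b (λ j → f (a + j))
sumBelow-split a zero    f = trans (cong (λ l → sumBelow l f) (+-identityʳ a)) (sym (+-identityʳ _))
sumBelow-split a (suc b) f = begin
  sumBelow (a + suc b) f                                        ≡⟨ cong (λ l → sumBelow l f) (+-suc a b) ⟩
  sumBelow (a + b) f + f (a + b)                                ≡⟨ cong (_+ f (a + b)) (sumBelow-split a b f) ⟩
  sumBelow a f + sumBelow b (λ j → f (a + j)) + f (a + b)       ≡⟨ +-assoc (sumBelow a f) _ _ ⟩
  sumBelow a f + sumBelow (suc b) (λ j → f (a + j))             ∎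
  where open ≡-Reasoning

sumBelow-head : ∀ l (f : ℕ → ℕ) → sumBelow (suc l) f ≡ f 0 + sumBelow l (λ j → f (suc j))
sumBelow-head l f = sumBelow-split 1 l f

sumBelow-+ : ∀ l (f g : ℕ → ℕ) → sumBelow l (λ j → f j + g j) ≡ sumBelow l f + sumBelow l g
sumBelow-+ zero    f g = refl
sumBelow-+ (suc l) f g =
  trans (cong (_+ (f l + g l)) (sumBelow-+ l f g)) (interchange (sumBelow l f) (sumBelow l g) (f l) (g l))

sumBelow-zero : ∀ l → sumBelow l (λ _ → 0) ≡ 0
sumBelow-zero zero    = refl
sumBelow-zero (suc l) = trans (+-identityʳ _) (sumBelow-zero l)

indicator : {A : Set} → Dec A → ℕ
indicator d = if does d then 1 else 0

module _ {P : ℕ → Set} (P? : Decidable P) where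

  -- count M = #{ c < M | P c }; as a function of c, count c is the rank of c among the P-points.
  count : ℕ → ℕ
  count M = sumBelow M (λ c → indicator (P? c))

  count-mono : ∀ {a} b → a ≤ b → count a ≤ count b
  count-mono zero    z≤n   = ≤-refl
  count-mono (suc b) a≤1+b with m≤n⇒m<n∨m≡n a≤1+b
  ... | inj₁ a<1+b = ≤-trans (count-mono b (m<1+n⇒m≤n a<1+b)) (m≤m+n (count b) _)
  ... | inj₂ refl  = ≤-refl

  count-step : ∀ {a} → P a → count a < count (suc a)
  count-step {a} pa with P? a
  ... | yes _  = ≤-reflexive (+-comm 1 (count a))
  ... | no ¬pa = contradiction pa ¬pa

  count-strict : ∀ {a b} → P a → a < b → count a < count b
  count-strict {b = b} pa a<b = ≤-trans (count-step pa) (count-mono b a<b)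

  count-injective : ∀ {a b} → P a → P b → count a ≡ count b → a ≡ b
  count-injective {a} {b} pa pb eq with <-cmp a b
  ... | tri< a<b _ _ = contradiction eq (<⇒≢ (count-strict pa a<b))
  ... | tri≈ _ a≡b _ = a≡b
  ... | tri> _ _ b<a = contradiction (sym eq) (<⇒≢ (count-strict pb b<a))

  count-surjective : ∀ M q → q < count M → ∃ λ c → c < M × P c × count c ≡ q
  count-surjective zero    q ()
  count-surjective (suc M) q q<count with q <? count M
  ... | yes q<countM =
    let (c , c<M , pc , rank≡q) = count-surjective M q q<countM in c , m<n⇒m<1+n c<M , pc , rank≡q
  ... | no q≮countM with P? M
  ...   | yes pM = M , ≤-refl , pM ,
                   ≤-antisym (≮⇒≥ q≮countM) (m<1+n⇒m≤n (subst (q <_) (+-comm (count M) 1) q<count))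
  ...   | no _   = contradiction (subst (q <_) (+-identityʳ (count M)) q<count) q≮countM

  -- Ranking identifies the P-points below M with Fin (count M).
  module Enumeration (M : ℕ) where

    index : ∀ {c} → c < M → P c → Fin (count M)
    index c<M pc = fromℕ< (count-strict pc c<M)

    toℕ-index : ∀ {c} (c<M : c < M) (pc : P c) → toℕ (index c<M pc) ≡ count c
    toℕ-index c<M pc = toℕ-fromℕ< (count-strict pc c<M)

    index-cong : ∀ {c c'} (c<M : c < M) (pc : P c) (c'<M : c' < M) (pc' : P c') →
                 c ≡ c' → index c<M pc ≡ index c'<M pc'
    index-cong c<M pc c'<M pc' refl =
      toℕ-injective (trans (toℕ-index c<M pc) (sym (toℕ-index c'<M pc')))

    index-injective : ∀ {c c'} (c<M : c < M) (pc : P c) (c'<M : c' < M) (pc' : P c') →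
                      index c<M pc ≡ index c'<M pc' → c ≡ c'
    index-injective c<M pc c'<M pc' eq =
      count-injective pc pc' (trans (sym (toℕ-index c<M pc)) (trans (cong toℕ eq) (toℕ-index c'<M pc')))

    private
      preimage : (q : Fin (count M)) → ∃ λ c → c < M × P c × count c ≡ toℕ q
      preimage q = count-surjective M (toℕ q) (toℕ<n q)

    element : Fin (count M) → ℕ
    element q = proj₁ (preimage q)

    element-< : ∀ q → element q < M
    element-< q = proj₁ (proj₂ (preimage q))

    element-P : ∀ q → P (element q)
    element-P q = proj₁ (proj₂ (proj₂ (preimage q)))

    index-element : ∀ q → index (element-< q) (element-P q) ≡ q
    index-element q =
      toℕ-injective (trans (toℕ-index (element-< q) (element-P q)) (proj₂ (proj₂ (proj₂ (preimage q)))))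

    element-injective : ∀ {q q'} → element q ≡ element q' → q ≡ q'
    element-injective {q} {q'} eq = trans (sym (index-element q))
      (trans (index-cong (element-< q) (element-P q) (element-< q') (element-P q') eq) (index-element q'))

double : ℕ → ℕ
double zero    = zero
double (suc x) = suc (suc (double x))

-- pow2 N = 2 ^ N, built from double so that digit manipulations are structural.
pow2 : ℕ → ℕ
pow2 zero    = 1
pow2 (suc N) = double (pow2 N)

cons : Bool → ℕ → ℕ
cons false x = double x
cons true  x = suc (double x)

lowBit : ℕ → Bool
lowBit zero          = false
lowBit (suc zero)    = true
lowBit (suc (suc c)) = lowBit c

half : ℕ → ℕ
half zero          = zero
half (suc zero)    = zero
half (suc (suc c)) = suc (half c)

bitAt : ℕ → ℕ → Bool
bitAt c zero    = lowBit c
bitAt c (suc i) = bitAt (half c) i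

encode : ℕ → (ℕ → Bool) → ℕ
encode zero    s = 0
encode (suc N) s = cons (s 0) (encode N (λ i → s (suc i)))

lowBit-cons : ∀ b x → lowBit (cons b x) ≡ b
lowBit-cons false zero    = refl
lowBit-cons false (suc x) = lowBit-cons false x
lowBit-cons true  zero    = refl
lowBit-cons true  (suc x) = lowBit-cons true x

half-cons : ∀ b x → half (cons b x) ≡ x
half-cons false zero    = refl
half-cons false (suc x) = cong suc (half-cons false x)
half-cons true  zero    = refl
half-cons true  (suc x) = cong suc (half-cons true x)

cons-suc : ∀ b x → cons b (suc x) ≡ suc (suc (cons b x))
cons-suc false x = refl
cons-suc true  x = refl

cons-lowBit-half : ∀ c → cons (lowBit c) (half c) ≡ c
cons-lowBit-half zero          = refl
cons-lowBit-half (suc zero)    = refl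
cons-lowBit-half (suc (suc c)) =
  trans (cons-suc (lowBit c) (half c)) (cong (λ x → suc (suc x)) (cons-lowBit-half c))

half-< : ∀ c k → c < double k → half c < k
half-< zero          (suc k) _               = z<s
half-< (suc zero)    (suc k) _               = z<s
half-< (suc (suc c)) (suc k) (s≤s (s≤s c<)) = s≤s (half-< c k c<)

cons-< : ∀ b x k → x < k → cons b x < double k
cons-< false zero    (suc k) _         = z<s
cons-< true  zero    (suc k) _         = s≤s z<s
cons-< b     (suc x) (suc k) (s≤s x<k) =
  subst (_< double (suc k)) (sym (cons-suc b x)) (s≤s (s≤s (cons-< b x k x<k)))

encode-cong : ∀ N {s t : ℕ → Bool} → (∀ i → i < N → s i ≡ t i) → encode N s ≡ encode N t
encode-cong zero    s≗t = refl
encode-cong (suc N) s≗t = cong₂ cons (s≗t 0 z<s) (encode-cong N (λ i i<N → s≗t (suc i) (s≤s i<N)))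

encode-< : ∀ N s → encode N s < pow2 N
encode-< zero    s = z<s
encode-< (suc N) s = cons-< (s 0) _ _ (encode-< N (λ i → s (suc i)))

bitAt-encode : ∀ N s i → i < N → bitAt (encode N s) i ≡ s i
bitAt-encode (suc N) s zero    _         = lowBit-cons (s 0) _
bitAt-encode (suc N) s (suc i) (s≤s i<N) =
  trans (cong (λ x → bitAt x i) (half-cons (s 0) _)) (bitAt-encode N (λ i → s (suc i)) i i<N)

encode-bitAt : ∀ N c → c < pow2 N → encode N (bitAt c) ≡ c
encode-bitAt zero    zero    _             = refl
encode-bitAt zero    (suc c) (s≤s ())
encode-bitAt (suc N) c       c<2ᴺ⁺¹ =
  trans (cong (cons (lowBit c)) (encode-bitAt N (half c) (half-< c (pow2 N) c<2ᴺ⁺¹))) (cons-lowBit-half c)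

bitValue : Bool → ℕ
bitValue true  = 1
bitValue false = 0

weight : ℕ → ℕ → ℕ
weight N c = sumBelow N (λ i → bitValue (bitAt c i))

weight-cons : ∀ N b x → weight (suc N) (cons b x) ≡ bitValue b + weight N x
weight-cons N b x = begin
  weight (suc N) (cons b x)                                 ≡⟨ sumBelow-head N _ ⟩
  bitValue (lowBit (cons b x)) + weight N (half (cons b x)) ≡⟨ cong₂ (λ b' x' → bitValue b' + weight N x')
                                                                     (lowBit-cons b x) (half-cons b x) ⟩
  bitValue b + weight N x                                   ∎
  where open ≡-Reasoning

sumBelow-double : ∀ M (f : ℕ → ℕ) →
                  sumBelow (double M) f ≡ sumBelow M (λ c → f (cons false c) + f (cons true c))
sumBelow-double zero    f = refl
sumBelow-double (suc M) f =
  trans (cong (λ s → s + f (double M) + f (suc (double M))) (sumBelow-double M f))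
        (+-assoc (sumBelow M (λ c → f (cons false c) + f (cons true c))) (f (double M)) (f (suc (double M))))

count-weight-step : ∀ N k →
  count (λ c → weight (suc N) c ≟ k) (pow2 (suc N))
    ≡ count (λ c → weight N c ≟ k) (pow2 N) + count (λ c → suc (weight N c) ≟ k) (pow2 N)
count-weight-step N k = begin
  sumBelow (double (pow2 N)) (λ c → indicator (weight (suc N) c ≟ k))
    ≡⟨ sumBelow-double (pow2 N) _ ⟩
  sumBelow (pow2 N) (λ c → indicator (weight (suc N) (cons false c) ≟ k)
                          + indicator (weight (suc N) (cons true c) ≟ k))
    ≡⟨ sumBelow-cong (pow2 N) (λ c _ → cong₂ (λ u v → indicator (u ≟ k) + indicator (v ≟ k))
                                             (weight-cons N false c) (weight-cons N true c)) ⟩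
  sumBelow (pow2 N) (λ c → indicator (weight N c ≟ k) + indicator (suc (weight N c) ≟ k))
    ≡⟨ sumBelow-+ (pow2 N) _ _ ⟩
  count (λ c → weight N c ≟ k) (pow2 N) + count (λ c → suc (weight N c) ≟ k) (pow2 N) ∎
  where open ≡-Reasoning

count-weight : ∀ N k → count (λ c → weight N c ≟ k) (pow2 N) ≡ N C k
count-weight zero    zero    = refl
count-weight zero    (suc k) = refl
count-weight (suc N) zero    =
  trans (count-weight-step N 0) (cong₂ _+_ (count-weight N 0) (sumBelow-zero (pow2 N)))
count-weight (suc N) (suc k) = begin
  count (λ c → weight (suc N) c ≟ suc k) (pow2 (suc N)) ≡⟨ count-weight-step N (suc k) ⟩
  count (λ c → weight N c ≟ suc k) (pow2 N) + count (λ c → weight N c ≟ k) (pow2 N)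
    ≡⟨ cong₂ _+_ (count-weight N (suc k)) (count-weight N k) ⟩
  N C suc k + N C k                                     ≡⟨ +-comm (N C suc k) (N C k) ⟩
  N C k + N C suc k                                     ≡⟨ nCk+nC[k+1]≡[n+1]C[k+1] N k ⟩
  suc N C suc k                                         ∎
  where open ≡-Reasoning

absorption : ∀ N k → suc k * (suc N C suc k) ≡ suc N * (N C k)
absorption zero    zero    = refl
absorption zero    (suc k) = *-zeroʳ (suc (suc k))
absorption (suc N) zero    = trans (*-identityˡ _) (trans (nC1≡n (suc (suc N))) (sym (*-identityʳ _)))
absorption (suc N) (suc k) = begin
  2+k * (suc (suc N) C 2+k)                 ≡⟨ cong (2+k *_) (sym (pascal (suc N) (suc k))) ⟩
  2+k * (a + b)                             ≡⟨ expand k a b ⟩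
  suc k * a + a + 2+k * b                   ≡⟨ cong₂ (λ u v → u + a + v) (absorption N k) (absorption N (suc k)) ⟩
  suc N * x + a + suc N * y                 ≡⟨ cong (λ u → suc N * x + u + suc N * y) (sym (pascal N k)) ⟩
  suc N * x + (x + y) + suc N * y           ≡⟨ collect N x y ⟩
  suc (suc N) * (x + y)                     ≡⟨ cong (suc (suc N) *_) (pascal N k) ⟩
  suc (suc N) * a                           ∎
  where
  open ≡-Reasoning
  pascal : ∀ N k → N C k + N C suc k ≡ suc N C suc k
  pascal = nCk+nC[k+1]≡[n+1]C[k+1]
  2+k a b x y : ℕ
  2+k = suc (suc k)
  a = suc N C suc k
  b = suc N C 2+k
  x = N C k
  y = N C suc k
  expand : ∀ k a b → suc (suc k) * (a + b) ≡ suc k * a + a + suc (suc k) * b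
  expand = solve-∀
  collect : ∀ N x y → suc N * x + (x + y) + suc N * y ≡ suc (suc N) * (x + y)
  collect = solve-∀

central-binomial-shift : ∀ m → let n = suc m in suc n * ((n + n) C suc n) ≡ n * ((n + n) C n)
central-binomial-shift m = begin
  suc n * (suc N C suc n) ≡⟨ absorption N n ⟩
  suc N * (N C n)         ≡⟨ cong (λ k → suc N * (N C k)) (sym (m+n∸m≡n m n)) ⟩
  suc N * (N C (N ∸ m))   ≡⟨ cong (suc N *_) (sym (nCk≡nC[n∸k] (m≤m+n m n))) ⟩
  suc N * (N C m)         ≡⟨ sym (absorption N m) ⟩
  n * (suc N C n)         ∎
  where
  open ≡-Reasoning
  n N : ℕ
  n = suc m
  N = m + n

catalan-from-ballot : ∀ m g → suc m * g ≡ (suc m + suc m) C suc (suc m) → g ≡ catalan (suc m)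
catalan-from-ballot m g ng≡ballot = begin
  g                             ≡⟨ sym (m*n/n≡m g (suc n)) ⟩
  (g * suc n) / suc n           ≡⟨ cong (_/ suc n) (trans (*-comm g (suc n)) [n+1]g≡central) ⟩
  ((n + n) C n) / suc n         ≡⟨ cong (λ l → (l C n) / suc n) (cong (n +_) (sym (+-identityʳ n))) ⟩
  ((2 * n) C n) / suc n         ∎
  where
  open ≡-Reasoning
  n : ℕ
  n = suc m
  reorder : ∀ a b → a * (suc a * b) ≡ suc a * (a * b)
  reorder = solve-∀
  [n+1]g≡central : suc n * g ≡ (n + n) C n
  [n+1]g≡central = *-cancelˡ-≡ (suc n * g) ((n + n) C n) n (begin
    n * (suc n * g)              ≡⟨ reorder n g ⟩
    suc n * (n * g)              ≡⟨ cong (suc n *_) ng≡ballot ⟩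
    suc n * ((n + n) C suc n)    ≡⟨ central-binomial-shift m ⟩
    n * ((n + n) C n)            ∎)

rowOnes-head : ∀ {k} (r : Fin (suc k) → Bool) → rowOnes r ≡ bitValue (r zero) + rowOnes (λ j → r (suc j))
rowOnes-head r with r zero
... | true  = refl
... | false = refl

rowOnes-sumBelow : ∀ {k} (r : Fin k → Bool) (h : ℕ → Bool) → (∀ j → r j ≡ h (toℕ j)) →
                   rowOnes r ≡ sumBelow k (λ j → bitValue (h j))
rowOnes-sumBelow {zero}  r h r≗h = refl
rowOnes-sumBelow {suc k} r h r≗h = begin
  rowOnes r                                                ≡⟨ rowOnes-head r ⟩
  bitValue (r zero) + rowOnes (λ j → r (suc j))            ≡⟨ cong₂ _+_ (cong bitValue (r≗h zero))
                                                                       (rowOnes-sumBelow _ _ (λ j → r≗h (suc j))) ⟩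
  bitValue (h 0) + sumBelow k (λ j → bitValue (h (suc j))) ≡⟨ sym (sumBelow-head k _) ⟩
  sumBelow (suc k) (λ j → bitValue (h j))                  ∎
  where open ≡-Reasoning

-- lastMinimiser F k is the last position b ≤ k at which F b − b is smallest
-- (comparisons are written additively, F b + j ≤ F j + b, to stay within ℕ).
lastMinimiser : (ℕ → ℕ) → ℕ → ℕ
lastMinimiser F zero    = 0
lastMinimiser F (suc k) with F (suc k) + lastMinimiser F k ≤? F (lastMinimiser F k) + suc k
... | yes _ = suc k
... | no  _ = lastMinimiser F k

record IsLastMinimiser (F : ℕ → ℕ) (k b : ℕ) : Set where
  field
    bounded : b ≤ k
    minimal : ∀ j → j ≤ k → F b + j ≤ F j + b
    last    : ∀ j → b < j → j ≤ k → F b + j < F j + b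

-- The comparison F x − x ≤ F y − y is transitive.
shifted-≤-trans : ∀ x y z j b k → x + j ≤ y + b → z + b ≤ x + k → z + j ≤ y + k
shifted-≤-trans x y z j b k xj≤yb zb≤xk = +-cancelʳ-≤ (x + b) (z + j) (y + k)
  (subst₂ _≤_ (swap₁ x z j b) (swap₂ x y b k) (+-mono-≤ xj≤yb zb≤xk))
  where
  swap₁ : ∀ x z j b → x + j + (z + b) ≡ z + j + (x + b)
  swap₁ = solve-∀
  swap₂ : ∀ x y b k → y + b + (x + k) ≡ y + k + (x + b)
  swap₂ = solve-∀

lastMinimiser-spec : ∀ F k → IsLastMinimiser F k (lastMinimiser F k)
lastMinimiser-spec F zero = record
  { bounded = z≤n
  ; minimal = λ { zero z≤n → ≤-refl }
  ; last    = λ j 0<j j≤0 → contradiction (≤-trans 0<j j≤0) λ ()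
  }
lastMinimiser-spec F (suc k)
  with lastMinimiser-spec F k | F (suc k) + lastMinimiser F k ≤? F (lastMinimiser F k) + suc k
... | spec | yes new≤old = record
  { bounded = ≤-refl
  ; minimal = minimal
  ; last    = λ j k<j j≤k → contradiction (≤-trans k<j j≤k) 1+n≰n
  }
  where
  open IsLastMinimiser spec using () renaming (minimal to minimalₖ)
  minimal : ∀ j → j ≤ suc k → F (suc k) + j ≤ F j + suc k
  minimal j j≤1+k with m≤n⇒m<n∨m≡n j≤1+k
  ... | inj₁ j<1+k = shifted-≤-trans (F (lastMinimiser F k)) (F j) (F (suc k)) j (lastMinimiser F k) (suc k)
                                     (minimalₖ j (m<1+n⇒m≤n j<1+k)) new≤old
  ... | inj₂ refl  = ≤-refl
... | spec | no new≰old = record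
  { bounded = m≤n⇒m≤1+n bounded
  ; minimal = minimal′
  ; last    = last′
  }
  where
  open IsLastMinimiser spec
  b : ℕ
  b = lastMinimiser F k
  old<new : F b + suc k < F (suc k) + b
  old<new = ≰⇒> new≰old
  minimal′ : ∀ j → j ≤ suc k → F b + j ≤ F j + b
  minimal′ j j≤1+k with m≤n⇒m<n∨m≡n j≤1+k
  ... | inj₁ j<1+k = minimal j (m<1+n⇒m≤n j<1+k)
  ... | inj₂ refl  = <⇒≤ old<new
  last′ : ∀ j → b < j → j ≤ suc k → F b + j < F j + b
  last′ j b<j j≤1+k with m≤n⇒m<n∨m≡n j≤1+k
  ... | inj₁ j<1+k = last j b<j (m<1+n⇒m≤n j<1+k)
  ... | inj₂ refl  = old<new

module CyclicClasses (m : ℕ) where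

  n : ℕ
  n = suc m

  -- Matrices are functions, so they are compared pointwise.
  _≈_ : Matrix n → Matrix n → Set
  A ≈ B = ∀ i j → A i j ≡ B i j

  ≈-sym : ∀ {A B} → A ≈ B → B ≈ A
  ≈-sym A≈B i j = sym (A≈B i j)

  ≈-trans : ∀ {A B C} → A ≈ B → B ≈ C → A ≈ C
  ≈-trans A≈B B≈C i j = trans (A≈B i j) (B≈C i j)

  toℕ-mod : ∀ x → toℕ (x mod n) ≡ x % n
  toℕ-mod x = toℕ-fromℕ< (m%n<n x n)

  mod-cong : ∀ x y → x % n ≡ y % n → x mod n ≡ y mod n
  mod-cong x y x≡y = toℕ-injective (trans (toℕ-mod x) (trans x≡y (sym (toℕ-mod y))))

  mod-toℕ : ∀ (j : Fin n) → toℕ j mod n ≡ j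
  mod-toℕ j = toℕ-injective (trans (toℕ-mod (toℕ j)) (m<n⇒m%n≡m (toℕ<n j)))

  %-+ˡ : ∀ x k → (x % n + k) % n ≡ (x + k) % n
  %-+ˡ x k = begin
    (x % n + k) % n         ≡⟨ %-distribˡ-+ (x % n) k n ⟩
    (x % n % n + k % n) % n ≡⟨ cong (λ r → (r + k % n) % n) (m%n%n≡m%n x n) ⟩
    (x % n + k % n) % n     ≡⟨ sym (%-distribˡ-+ x k n) ⟩
    (x + k) % n             ∎
    where open ≡-Reasoning

  %-+ʳ : ∀ x k → (x + k % n) % n ≡ (x + k) % n
  %-+ʳ x k = trans (cong (_% n) (+-comm x (k % n))) (trans (%-+ˡ k x) (cong (_% n) (+-comm k x)))

  mod-shift : ∀ x k → (toℕ (x mod n) + k) mod n ≡ (x + k) mod n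
  mod-shift x k =
    mod-cong (toℕ (x mod n) + k) (x + k) (trans (cong (λ r → (r + k) % n) (toℕ-mod x)) (%-+ˡ x k))

  rotate-cong : ∀ k {A B} → A ≈ B → rotate k A ≈ rotate k B
  rotate-cong k A≈B i j = A≈B i _

  rotate-≡ : ∀ {a b} A → a ≡ b → rotate a A ≈ rotate b A
  rotate-≡ A refl i j = refl

  rotate-+ : ∀ d a A → rotate d (rotate a A) ≈ rotate (d + a) A
  rotate-+ d a A i j = cong (A i) (trans (mod-shift (toℕ j + d) a) (cong (_mod n) (+-assoc (toℕ j) d a)))

  rotate-mod : ∀ {k k'} A → k % n ≡ k' % n → rotate k A ≈ rotate k' A
  rotate-mod {k} {k'} A k≡k' i j = cong (A i) (mod-cong (toℕ j + k) (toℕ j + k') (begin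
    (toℕ j + k) % n      ≡⟨ sym (%-+ʳ (toℕ j) k) ⟩
    (toℕ j + k % n) % n  ≡⟨ cong (λ r → (toℕ j + r) % n) k≡k' ⟩
    (toℕ j + k' % n) % n ≡⟨ %-+ʳ (toℕ j) k' ⟩
    (toℕ j + k') % n     ∎))
    where open ≡-Reasoning

  rotate-0 : ∀ A → rotate 0 A ≈ A
  rotate-0 A i j = cong (A i) (trans (cong (_mod n) (+-identityʳ (toℕ j))) (mod-toℕ j))

  rotate-undo : ∀ {k} A → k ≤ n → rotate (n ∸ k) (rotate k A) ≈ A
  rotate-undo {k} A k≤n = ≈-trans (rotate-+ (n ∸ k) k A) (≈-trans (rotate-mod A period) (rotate-0 A))
    where
    period : (n ∸ k + k) % n ≡ 0 % n
    period = trans (cong (_% n) (m∸n+n≡m k≤n)) ([m+n]%n≡m%n 0 n)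

  rotate-cancel : ∀ {k A B} → k ≤ n → rotate k A ≈ rotate k B → A ≈ B
  rotate-cancel {k} {A} {B} k≤n eq =
    ≈-trans (≈-sym (rotate-undo A k≤n)) (≈-trans (rotate-cong (n ∸ k) eq) (rotate-undo B k≤n))

  columnWeightAt : Matrix n → Fin n → ℕ
  columnWeightAt A j = bitValue (A zero j) + bitValue (A (suc zero) j)

  columnWeight : Matrix n → ℕ → ℕ
  columnWeight A x = columnWeightAt A (x mod n)

  window : Matrix n → ℕ → ℕ → ℕ
  window A a l = sumBelow l (λ j → columnWeight A (a + j))

  columnWeight-mod : ∀ A x y → x % n ≡ y % n → columnWeight A x ≡ columnWeight A y
  columnWeight-mod A x y x≡y = cong (columnWeightAt A) (mod-cong x y x≡y)

  window-cong : ∀ {A B} → A ≈ B → ∀ a l → window A a l ≡ window B a l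
  window-cong A≈B a l = sumBelow-cong l (λ j _ →
    cong₂ _+_ (cong bitValue (A≈B zero _)) (cong bitValue (A≈B (suc zero) _)))

  window-split : ∀ A a l₁ l₂ → window A a (l₁ + l₂) ≡ window A a l₁ + window A (a + l₁) l₂
  window-split A a l₁ l₂ = trans (sumBelow-split l₁ l₂ _)
    (cong (window A a l₁ +_) (sumBelow-cong l₂ (λ j _ → cong (columnWeight A) (sym (+-assoc a l₁ j)))))

  window-rotate : ∀ k A l → window (rotate k A) 0 l ≡ window A k l
  window-rotate k A l = sumBelow-cong l (λ j _ →
    trans (cong (columnWeightAt A) (mod-shift j k)) (cong (columnWeight A) (+-comm j k)))

  window-period : ∀ A b l → window A (b + n) l ≡ window A b l
  window-period A b l = sumBelow-cong l (λ j _ →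
    columnWeight-mod A (b + n + j) (b + j) (trans (cong (_% n) (xy∙z≈xz∙y b n j)) ([m+n]%n≡m%n (b + j) n)))

  window-full-< : ∀ A a → a < n → window A a n ≡ window A 0 n
  window-full-< A a a<n = begin
    window A a n                     ≡⟨ cong (window A a) (sym u+a≡n) ⟩
    window A a (u + a)               ≡⟨ window-split A a u a ⟩
    window A a u + window A (a + u) a ≡⟨ cong (λ b → window A a u + window A b a) a+u≡n ⟩
    window A a u + window A n a      ≡⟨ cong (window A a u +_) (window-period A 0 a) ⟩
    window A a u + window A 0 a      ≡⟨ +-comm (window A a u) (window A 0 a) ⟩
    window A 0 a + window A a u      ≡⟨ sym (window-split A 0 a u) ⟩
    window A 0 (a + u)               ≡⟨ cong (window A 0) a+u≡n ⟩
    window A 0 n                     ∎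
    where
    open ≡-Reasoning
    u : ℕ
    u = n ∸ a
    a+u≡n : a + u ≡ n
    a+u≡n = m+[n∸m]≡n (<⇒≤ a<n)
    u+a≡n : u + a ≡ n
    u+a≡n = m∸n+n≡m (<⇒≤ a<n)

  window-full : ∀ A a → window A a n ≡ window A 0 n
  window-full A a = trans
    (sumBelow-cong n (λ j _ → columnWeight-mod A (a + j) (a % n + j) (sym (%-+ˡ a j))))
    (window-full-< A (a % n) (m%n<n a n))

  ones≡window : ∀ A → ones A ≡ window A 0 n
  ones≡window A = trans (cong₂ _+_ (row zero) (row (suc zero))) (sym (sumBelow-+ n _ _))
    where
    row : ∀ i → rowOnes (A i) ≡ sumBelow n (λ j → bitValue (A i (j mod n)))
    row i = rowOnes-sumBelow (A i) (λ j → A i (j mod n)) (λ j → cong (A i) (sym (mod-toℕ j)))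

  ones-cong : ∀ {A B} → A ≈ B → ones A ≡ ones B
  ones-cong {A} {B} A≈B = trans (ones≡window A) (trans (window-cong A≈B 0 n) (sym (ones≡window B)))

  ones-rotate : ∀ k A → ones (rotate k A) ≡ ones A
  ones-rotate k A = begin
    ones (rotate k A)           ≡⟨ ones≡window (rotate k A) ⟩
    window (rotate k A) 0 n     ≡⟨ window-rotate k A n ⟩
    window A k n                ≡⟨ window-full A k ⟩
    window A 0 n                ≡⟨ sym (ones≡window A) ⟩
    ones A                      ∎
    where open ≡-Reasoning

  Dominant : Matrix n → Set
  Dominant A = ∀ {l} → l < n → suc l < window A 0 (suc l)

  dominant? : Decidable Dominant
  dominant? A = allUpTo? (λ l → suc l <? window A 0 (suc l)) n

  Dominant-cong : ∀ {A B} → A ≈ B → Dominant A → Dominant B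
  Dominant-cong A≈B domA {l} l<n = subst (suc l <_) (window-cong A≈B 0 (suc l)) (domA l<n)

  no-two-overfull-windows : ∀ G a b → ones G ≡ suc n → suc a + suc b ≡ n →
    suc a < window G 0 (suc a) → suc b < window G (suc a) (suc b) → ⊥
  no-two-overfull-windows G a b onesG split over₁ over₂ =
    1+n≰n (subst₂ _≤_ (+-suc (suc (suc a)) (suc b)) total (+-mono-≤ over₁ over₂))
    where
    total : window G 0 (suc a) + window G (suc a) (suc b) ≡ suc (suc a + suc b)
    total = begin
      window G 0 (suc a) + window G (suc a) (suc b) ≡⟨ sym (window-split G 0 (suc a) (suc b)) ⟩
      window G 0 (suc a + suc b)                    ≡⟨ cong (window G 0) split ⟩
      window G 0 n                                  ≡⟨ sym (ones≡window G) ⟩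
      ones G                                        ≡⟨ trans onesG (cong suc (sym split)) ⟩
      suc (suc a + suc b)                           ∎
      where open ≡-Reasoning

  dominant-rotation-trivial : ∀ G {d} → ones G ≡ suc n → Dominant G → Dominant (rotate d G) → d < n →
                              d ≡ 0
  dominant-rotation-trivial G {zero}  _     _    _       _   = refl
  dominant-rotation-trivial G {suc a} onesG domG domRot d<n =
    ⊥-elim (no-two-overfull-windows G a b onesG split (domG (<⇒≤ d<n)) second)
    where
    gap : ∃ λ o → suc (suc a) + o ≡ n
    gap = m≤n⇒∃[o]m+o≡n d<n
    b : ℕ
    b = proj₁ gap
    split : suc a + suc b ≡ n
    split = trans (+-suc (suc a) b) (proj₂ gap)
    second : suc b < window G (suc a) (suc b)
    second = subst (suc b <_) (window-rotate (suc a) G (suc b))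
                   (domRot (subst (b <_) split (≤-trans (n<1+n b) (m≤n+m (suc b) (suc a)))))

  prefix-period : ∀ A r → window A 0 (n + r) ≡ ones A + window A 0 r
  prefix-period A r =
    trans (window-split A 0 n r) (cong₂ _+_ (sym (ones≡window A)) (window-period A 0 r))

  -- Cycle lemma, existence: let t be the last position below n minimising F t − t, where F j is the
  -- number of ones in the first j columns.  Then F j − j > F t − t for all t < j ≤ t + n, so the
  -- rotation starting at column t is dominant.
  dominant-rotation-exists : ∀ A → ones A ≡ suc n → ∃ λ t → t < n × Dominant (rotate t A)
  dominant-rotation-exists A onesA = t , s≤s bounded , dominant
    where
    F : ℕ → ℕ
    F = window A 0
    t : ℕ
    t = lastMinimiser F m
    open IsLastMinimiser (lastMinimiser-spec F m)

    above : ∀ j → t < j → j ≤ t + n → F t + j < F j + t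
    above j t<j j≤t+n with j ≤? m
    ... | yes j≤m = last j t<j j≤m
    ... | no  j≰m = subst (λ j → F t + j < F j + t) n+r≡j beyond
      where
      r : ℕ
      r = j ∸ n
      n+r≡j : n + r ≡ j
      n+r≡j = m+[n∸m]≡n (≰⇒> j≰m)
      r≤t : r ≤ t
      r≤t = +-cancelˡ-≤ n r t (subst₂ _≤_ (sym n+r≡j) (+-comm t n) j≤t+n)
      beyond : F t + (n + r) < F (n + r) + t
      beyond = begin-strict
        F t + (n + r)     ≡⟨ x∙yz≈y∙xz (F t) n r ⟩
        n + (F t + r)     ≤⟨ +-monoʳ-≤ n (minimal r (≤-trans r≤t bounded)) ⟩
        n + (F r + t)     <⟨ n<1+n _ ⟩
        suc (n + (F r + t)) ≡⟨ cong suc (sym (+-assoc n (F r) t)) ⟩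
        suc n + F r + t   ≡⟨ cong (λ o → o + F r + t) (sym onesA) ⟩
        ones A + F r + t  ≡⟨ cong (_+ t) (sym (prefix-period A r)) ⟩
        F (n + r) + t     ∎
        where open ≤-Reasoning

    dominant : Dominant (rotate t A)
    dominant {l} l<n = subst (suc l <_) (sym (window-rotate t A (suc l)))
      (+-cancelˡ-< (F t + t) (suc l) (window A t (suc l)) (begin-strict
        F t + t + suc l                    ≡⟨ +-assoc (F t) t (suc l) ⟩
        F t + (t + suc l)                  <⟨ above (t + suc l) (m<m+n t z<s) (+-monoʳ-≤ t l<n) ⟩
        F (t + suc l) + t                  ≡⟨ cong (_+ t) (window-split A 0 t (suc l)) ⟩
        F t + window A t (suc l) + t       ≡⟨ xy∙z≈xz∙y (F t) _ t ⟩
        F t + t + window A t (suc l)       ∎))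
      where open ≤-Reasoning

  dominant-shift-unique-≤ : ∀ X {a b} → ones X ≡ suc n → a ≤ b → b < n →
                            Dominant (rotate a X) → Dominant (rotate b X) → a ≡ b
  dominant-shift-unique-≤ X {a} {b} onesX a≤b b<n domA domB = ≤-antisym a≤b (m∸n≡0⇒m≤n d≡0)
    where
    same : rotate (b ∸ a) (rotate a X) ≈ rotate b X
    same = ≈-trans (rotate-+ (b ∸ a) a X) (rotate-≡ X (m∸n+n≡m a≤b))
    d≡0 : b ∸ a ≡ 0
    d≡0 = dominant-rotation-trivial (rotate a X) (trans (ones-rotate a X) onesX) domA
                                    (Dominant-cong (≈-sym same) domB) (≤-<-trans (m∸n≤m b a) b<n)

  dominant-shift-unique : ∀ X {a b} → ones X ≡ suc n → a < n → b < n →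
                          Dominant (rotate a X) → Dominant (rotate b X) → a ≡ b
  dominant-shift-unique X {a} {b} onesX a<n b<n domA domB with ≤-total a b
  ... | inj₁ a≤b = dominant-shift-unique-≤ X onesX a≤b b<n domA domB
  ... | inj₂ b≤a = sym (dominant-shift-unique-≤ X onesX b≤a a<n domB domA)

  dominant-rotations-distinct-≤ : ∀ G G' {k k'} → ones G' ≡ suc n → Dominant G → Dominant G' →
                                  k ≤ k' → k' < n → rotate k G ≈ rotate k' G' → k ≡ k' × G ≈ G'
  dominant-rotations-distinct-≤ G G' {k} {k'} onesG' domG domG' k≤k' k'<n same =
    ≤-antisym k≤k' (m∸n≡0⇒m≤n d≡0) , ≈-trans G≈ (≈-trans (rotate-≡ G' d≡0) (rotate-0 G'))
    where
    d : ℕ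
    d = k' ∸ k
    G≈ : G ≈ rotate d G'
    G≈ = rotate-cancel (≤-trans k≤k' (<⇒≤ k'<n))
           (≈-trans same (≈-sym (≈-trans (rotate-+ k d G') (rotate-≡ G' (m+[n∸m]≡n k≤k')))))
    d≡0 : d ≡ 0
    d≡0 = dominant-rotation-trivial G' onesG' domG' (Dominant-cong G≈ domG) (≤-<-trans (m∸n≤m k' k) k'<n)

  dominant-rotations-distinct : ∀ G G' {k k'} → ones G ≡ suc n → ones G' ≡ suc n →
                                Dominant G → Dominant G' → k < n → k' < n →
                                rotate k G ≈ rotate k' G' → k ≡ k' × G ≈ G'
  dominant-rotations-distinct G G' {k} {k'} onesG onesG' domG domG' k<n k'<n same with ≤-total k k'
  ... | inj₁ k≤k' = dominant-rotations-distinct-≤ G G' onesG' domG domG' k≤k' k'<n same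
  ... | inj₂ k'≤k =
    let (k'≡k , G'≈G) = dominant-rotations-distinct-≤ G' G onesG domG' domG k'≤k k<n (≈-sym same)
    in sym k'≡k , ≈-sym G'≈G

  -- A matrix is stored as the 2n-digit binary number whose digits are row 0 followed by row 1.
  entry : Matrix n → ℕ → Bool
  entry A i with i <? n
  ... | yes i<n = A zero (fromℕ< i<n)
  ... | no  _   = A (suc zero) ((i ∸ n) mod n)

  code : Matrix n → ℕ
  code A = encode (n + n) (entry A)

  matrix : ℕ → Matrix n
  matrix c zero       j = bitAt c (toℕ j)
  matrix c (suc zero) j = bitAt c (n + toℕ j)

  codeBound : ℕ
  codeBound = pow2 (n + n)

  entry-cong : ∀ {A B} → A ≈ B → ∀ i → entry A i ≡ entry B i
  entry-cong A≈B i with i <? n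
  ... | yes _ = A≈B zero _
  ... | no  _ = A≈B (suc zero) _

  entry-top : ∀ A j → entry A (toℕ j) ≡ A zero j
  entry-top A j with toℕ j <? n
  ... | yes j<n = cong (A zero) (fromℕ<-toℕ j j<n)
  ... | no  j≮n = contradiction (toℕ<n j) j≮n

  entry-bottom : ∀ A j → entry A (n + toℕ j) ≡ A (suc zero) j
  entry-bottom A j with n + toℕ j <? n
  ... | yes n+j<n = contradiction n+j<n (m+n≮m n (toℕ j))
  ... | no  _     = cong (A (suc zero)) (trans (cong (_mod n) (m+n∸m≡n n (toℕ j))) (mod-toℕ j))

  entry-matrix : ∀ c i → i < n + n → entry (matrix c) i ≡ bitAt c i
  entry-matrix c i i<2n with i <? n
  ... | yes i<n = cong (bitAt c) (toℕ-fromℕ< i<n)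
  ... | no  i≮n =
    cong (bitAt c) (trans (cong (n +_) (trans (toℕ-mod (i ∸ n)) (m<n⇒m%n≡m i∸n<n))) (m+[n∸m]≡n n≤i))
    where
    n≤i : n ≤ i
    n≤i = ≮⇒≥ i≮n
    i∸n<n : i ∸ n < n
    i∸n<n = subst (i ∸ n <_) (m+n∸m≡n n n) (∸-monoˡ-< i<2n n≤i)

  matrix-code : ∀ A → matrix (code A) ≈ A
  matrix-code A zero       j = trans (bitAt-encode (n + n) (entry A) (toℕ j) (≤-trans (toℕ<n j) (m≤m+n n n)))
                                     (entry-top A j)
  matrix-code A (suc zero) j = trans (bitAt-encode (n + n) (entry A) (n + toℕ j) (+-monoʳ-< n (toℕ<n j)))
                                     (entry-bottom A j)

  code-cong : ∀ {A B} → A ≈ B → code A ≡ code B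
  code-cong A≈B = encode-cong (n + n) (λ i _ → entry-cong A≈B i)

  code-injective : ∀ {A B} → code A ≡ code B → A ≈ B
  code-injective {A} {B} eq i j =
    trans (sym (matrix-code A i j)) (trans (cong (λ c → matrix c i j) eq) (matrix-code B i j))

  code-< : ∀ A → code A < codeBound
  code-< A = encode-< (n + n) (entry A)

  code-matrix : ∀ c → c < codeBound → code (matrix c) ≡ c
  code-matrix c c<bound = trans (encode-cong (n + n) (entry-matrix c)) (encode-bitAt (n + n) c c<bound)

  ones-matrix : ∀ c → ones (matrix c) ≡ weight (n + n) c
  ones-matrix c = trans (cong₂ _+_ (rowOnes-sumBelow (matrix c zero) (bitAt c) (λ j → refl))
                                   (rowOnes-sumBelow (matrix c (suc zero)) (λ j → bitAt c (n + j)) (λ j → refl)))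
                        (sym (sumBelow-split n n _))

  Admissible : ℕ → Set
  Admissible c = weight (n + n) c ≡ suc n

  admissible? : Decidable Admissible
  admissible? c = weight (n + n) c ≟ suc n

  Canonical : ℕ → Set
  Canonical c = Admissible c × Dominant (matrix c)

  canonical? : Decidable Canonical
  canonical? c = admissible? c ×-dec dominant? (matrix c)

  module Admissibles = Enumeration admissible? codeBound
  module Canonicals  = Enumeration canonical? codeBound

  classCount : ℕ
  classCount = count canonical? codeBound

  code-admissible : ∀ A → ones A ≡ suc n → Admissible (code A)
  code-admissible A onesA = trans (sym (ones-matrix (code A))) (trans (ones-cong (matrix-code A)) onesA)

  code-canonical : ∀ A → ones A ≡ suc n → Dominant A → Canonical (code A)
  code-canonical A onesA domA = code-admissible A onesA , Dominant-cong (≈-sym (matrix-code A)) domA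

  matrix-ones : ∀ {c} → Admissible c → ones (matrix c) ≡ suc n
  matrix-ones {c} adm = trans (ones-matrix c) adm

  -- The class of x is represented by its unique dominant rotation.
  shift : Adm n → ℕ
  shift x = proj₁ (dominant-rotation-exists (proj₁ x) (proj₂ x))

  shift-< : ∀ x → shift x < n
  shift-< x = proj₁ (proj₂ (dominant-rotation-exists (proj₁ x) (proj₂ x)))

  representative : Adm n → Matrix n
  representative x = rotate (shift x) (proj₁ x)

  representative-dominant : ∀ x → Dominant (representative x)
  representative-dominant x = proj₂ (proj₂ (dominant-rotation-exists (proj₁ x) (proj₂ x)))

  representative-ones : ∀ x → ones (representative x) ≡ suc n
  representative-ones x = trans (ones-rotate (shift x) (proj₁ x)) (proj₂ x)

  shift-unique : ∀ x {k} → k < n → Dominant (rotate k (proj₁ x)) → shift x ≡ k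
  shift-unique x k<n domK =
    dominant-shift-unique (proj₁ x) (proj₂ x) (shift-< x) k<n (representative-dominant x) domK

  related⇒same-representative : ∀ x y → proj₁ x ∼ proj₁ y → representative x ≈ representative y
  related⇒same-representative x y (k , Y≈) = ≈-trans (rotate-≡ (proj₁ x) shift≡) (≈-sym repY≈)
    where
    k' : ℕ
    k' = (shift y + k) % n
    repY≈ : representative y ≈ rotate k' (proj₁ x)
    repY≈ = ≈-trans (rotate-cong (shift y) Y≈)
              (≈-trans (rotate-+ (shift y) k (proj₁ x))
                       (rotate-mod (proj₁ x) (sym (m%n%n≡m%n (shift y + k) n))))
    shift≡ : shift x ≡ k'
    shift≡ = shift-unique x (m%n<n (shift y + k) n) (Dominant-cong repY≈ (representative-dominant y))

  same-representative⇒related : ∀ x y → representative x ≈ representative y → proj₁ x ∼ proj₁ y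
  same-representative⇒related x y same = n ∸ shift y + shift x ,
    ≈-trans (≈-sym (rotate-undo (proj₁ y) (<⇒≤ (shift-< y))))
      (≈-trans (rotate-cong (n ∸ shift y) (≈-sym same)) (rotate-+ (n ∸ shift y) (shift x) (proj₁ x)))

  representative-canonical : ∀ x → Canonical (code (representative x))
  representative-canonical x =
    code-canonical (representative x) (representative-ones x) (representative-dominant x)

  class : Adm n → Fin classCount
  class x = Canonicals.index (code-< (representative x)) (representative-canonical x)

  class-≡ : ∀ x y → representative x ≈ representative y → class x ≡ class y
  class-≡ x y same = Canonicals.index-cong (code-< (representative x)) (representative-canonical x)
                                         (code-< (representative y)) (representative-canonical y) (code-cong same)

  class-≡⁻¹ : ∀ x y → class x ≡ class y → representative x ≈ representative y
  class-≡⁻¹ x y eq = code-injective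
    (Canonicals.index-injective (code-< (representative x)) (representative-canonical x)
                                (code-< (representative y)) (representative-canonical y) eq)

  decode : ∀ {c} → Admissible c → Adm n
  decode {c} adm = matrix c , matrix-ones adm

  -- Every canonical code is the class of the matrix it stores, which is its own representative.
  class-surjective : ∀ q → ∃ λ x → class x ≡ q
  class-surjective q = x , trans (Canonicals.index-cong (code-< (representative x)) (representative-canonical x)
                                                      (Canonicals.element-< q) (Canonicals.element-P q) code≡)
                                (Canonicals.index-element q)
    where
    c : ℕ
    c = Canonicals.element q
    x : Adm n
    x = decode (proj₁ (Canonicals.element-P q))
    shift≡0 : shift x ≡ 0
    shift≡0 = shift-unique x z<s (Dominant-cong (≈-sym (rotate-0 (matrix c))) (proj₂ (Canonicals.element-P q)))
    code≡ : code (representative x) ≡ c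
    code≡ = trans (code-cong (≈-trans (rotate-≡ (matrix c) shift≡0) (rotate-0 (matrix c))))
                  (code-matrix c (Canonicals.element-< q))

  classes : HasClasses {Adm n} (λ x y → proj₁ x ∼ proj₁ y) classCount
  classes = class , class-surjective , λ x y →
    (λ eq → same-representative⇒related x y (class-≡⁻¹ x y eq)) ,
    (λ rel → class-≡ x y (related⇒same-representative x y rel))

  -- Orbit counting: the admissible codes are exactly the n rotations of the canonical ones.
  admissibleCount : ℕ
  admissibleCount = count admissible? codeBound

  canonicalMatrix : Fin classCount → Matrix n
  canonicalMatrix q = matrix (Canonicals.element q)

  canonicalMatrix-ones : ∀ q → ones (canonicalMatrix q) ≡ suc n
  canonicalMatrix-ones q = matrix-ones (proj₁ (Canonicals.element-P q))

  canonicalMatrix-dominant : ∀ q → Dominant (canonicalMatrix q)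
  canonicalMatrix-dominant q = proj₂ (Canonicals.element-P q)

  rotated : Fin n → Fin classCount → Matrix n
  rotated k q = rotate (toℕ k) (canonicalMatrix q)

  rotated-admissible : ∀ k q → Admissible (code (rotated k q))
  rotated-admissible k q =
    code-admissible (rotated k q) (trans (ones-rotate (toℕ k) (canonicalMatrix q)) (canonicalMatrix-ones q))

  -- (k, q) ↦ the k-th rotation of the q-th canonical matrix; injective by the cycle lemma.
  rotationOf : Fin n × Fin classCount → Fin admissibleCount
  rotationOf (k , q) = Admissibles.index (code-< (rotated k q)) (rotated-admissible k q)

  rotationOf-injective : ∀ {p p'} → rotationOf p ≡ rotationOf p' → p ≡ p'
  rotationOf-injective {k , q} {k' , q'} eq =
    cong₂ _,_ (toℕ-injective (proj₁ distinct)) (Canonicals.element-injective elements≡)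
    where
    same : rotated k q ≈ rotated k' q'
    same = code-injective (Admissibles.index-injective (code-< (rotated k q)) (rotated-admissible k q)
                                                       (code-< (rotated k' q')) (rotated-admissible k' q') eq)
    distinct : toℕ k ≡ toℕ k' × canonicalMatrix q ≈ canonicalMatrix q'
    distinct = dominant-rotations-distinct (canonicalMatrix q) (canonicalMatrix q')
                 (canonicalMatrix-ones q) (canonicalMatrix-ones q')
                 (canonicalMatrix-dominant q) (canonicalMatrix-dominant q') (toℕ<n k) (toℕ<n k') same
    elements≡ : Canonicals.element q ≡ Canonicals.element q'
    elements≡ = trans (sym (code-matrix _ (Canonicals.element-< q)))
                  (trans (code-cong (proj₂ distinct)) (code-matrix _ (Canonicals.element-< q')))

  admissibleAt : Fin admissibleCount → Adm n
  admissibleAt r = decode (Admissibles.element-P r)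

  -- r ↦ (the shift to its representative, its class); injective since rotations can be undone.
  decompose : Fin admissibleCount → Fin n × Fin classCount
  decompose r = fromℕ< (shift-< (admissibleAt r)) , class (admissibleAt r)

  decompose-injective : ∀ {r r'} → decompose r ≡ decompose r' → r ≡ r'
  decompose-injective {r} {r'} eq = Admissibles.element-injective elements≡
    where
    x x' : Adm n
    x  = admissibleAt r
    x' = admissibleAt r'
    shift≡ : shift x ≡ shift x'
    shift≡ = trans (sym (toℕ-fromℕ< (shift-< x)))
                   (trans (cong (λ p → toℕ (proj₁ p)) eq) (toℕ-fromℕ< (shift-< x')))
    X≈ : proj₁ x ≈ proj₁ x'
    X≈ = rotate-cancel (<⇒≤ (shift-< x))
                       (≈-trans (class-≡⁻¹ x x' (cong proj₂ eq)) (rotate-≡ (proj₁ x') (sym shift≡)))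
    elements≡ : Admissibles.element r ≡ Admissibles.element r'
    elements≡ = trans (sym (code-matrix _ (Admissibles.element-< r)))
                  (trans (code-cong X≈) (code-matrix _ (Admissibles.element-< r')))

  orbit-count : n * classCount ≡ admissibleCount
  orbit-count = ≤-antisym
    (injective⇒≤ {f = λ i → rotationOf (remQuot classCount i)}
                 (λ eq → remQuot-injective (rotationOf-injective eq)))
    (injective⇒≤ {f = λ r → uncurry combine (decompose r)}
                 (λ eq → decompose-injective (combine-injective′ eq)))
    where
    remQuot-injective : ∀ {i j : Fin (n * classCount)} →
                        remQuot classCount i ≡ remQuot classCount j → i ≡ j
    remQuot-injective {i} {j} eq =
      trans (sym (combine-remQuot classCount i)) (trans (cong (uncurry combine) eq) (combine-remQuot classCount j))
    combine-injective′ : ∀ {p p' : Fin n × Fin classCount} →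
                         uncurry combine p ≡ uncurry combine p' → p ≡ p'
    combine-injective′ {i , j} {k , l} eq =
      let (i≡k , j≡l) = combine-injective i j k l eq in cong₂ _,_ i≡k j≡l

  classCount≡catalan : classCount ≡ catalan n
  classCount≡catalan = catalan-from-ballot m classCount (trans orbit-count (count-weight (n + n) (suc n)))

corollary4p3 : (m : ℕ) → HasClasses {Adm (suc m)} (λ A B → proj₁ A ∼ proj₁ B) (catalan (suc m))
corollary4p3 m = subst (HasClasses _) classCount≡catalan classes
  where open CyclicClasses m
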